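{- Let $G$ be a triangle-free graph with at least five vertices and minimum degree at least $3$. Let $G'$ be the graph with vertex set $V(G)\times\{0,1,2,3\}$ in which: for each $v\in V(G)$ the set $C_v=\{v\}\times\{0,1,2,3\}$ is a clique; the set $C=V(G)\times\{0\}$ is a clique; for each $i\in\{1,2,3\}$ and distinct $u,v\in V(G)$, $(u,i)$ and $(v,i)$ are adjacent iff $uv\in E(G)$; and there are no other edges. Let $G''$ be obtained from $G'$ by adding, for each vertex $w\in V(G')\setminus C$, a new vertex $w'$ adjacent only to $w$. Then $G'$ and $G''$ are diamond-free, and the following statements are equivalent: (1) $G$ is not $3$-colorable; (2) $C$ is a strong clique in $G'$; (3) $G'$ has a strong clique; (4) $C$ is a strong clique in $G''$; (5) every vertex of $G''$ is contained in a strong clique; (6) every clique in the collection $\{C\}\cup\{\{w,w'\}: w\in V(G')\setminus C\}$ is strong in $G''$; (7) the vertex set of $G''$ can be partitioned into strong cliques.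
   Context: Graphs are finite and simple. The diamond is $K_4$ minus an edge; diamond-free means no induced diamond. A clique is strong if it intersects every inclusion-maximal stable set of the graph. A graph is $3$-colorable if its vertex set can be partitioned into three stable sets. -}

module Defs where

open import Data.Nat using (ℕ; zero; suc; _≤_)
open import Data.Fin using (Fin; zero; suc)
open import Data.Fin.Properties using (_≟_)
open import Data.Bool using (Bool; true; false; _∧_; not; if_then_else_)
open import Data.Product using (_×_; _,_; Σ; ∃)
open import Data.Sum using (_⊎_; inj₁; inj₂)
open import Data.Vec using (tabulate)
open import Data.Fin.Subset using (∣_∣)
open import Relation.Nullary using (¬_)
open import Relation.Nullary.Decidable using (⌊_⌋)
open import Relation.Binary.PropositionalEquality using (_≡_; _≢_)

record Graph (V : Set) : Set where
  field
    adj : V → V → Bool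

open Graph public

VSet : Set → Set
VSet V = V → Bool

_∈_ : {V : Set} → V → VSet V → Set
x ∈ S = S x ≡ true

_⊆_ : {V : Set} → VSet V → VSet V → Set
S ⊆ T = ∀ x → x ∈ S → x ∈ T

module _ {V : Set} (G : Graph V) where

  Adj : V → V → Set
  Adj u v = adj G u v ≡ true

  IsSimple : Set
  IsSimple = (∀ u v → adj G u v ≡ adj G v u) × (∀ v → adj G v v ≡ false)

  IsStable : VSet V → Set
  IsStable S = ∀ u v → u ∈ S → v ∈ S → u ≢ v → ¬ Adj u v

  IsMaximalStable : VSet V → Set
  IsMaximalStable S = IsStable S × (∀ T → IsStable T → S ⊆ T → T ⊆ S)

  IsClique : VSet V → Set
  IsClique K = ∀ u v → u ∈ K → v ∈ K → u ≢ v → Adj u v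

  IsStrongClique : VSet V → Set
  IsStrongClique K = IsClique K × (∀ S → IsMaximalStable S → ∃ λ v → v ∈ K × v ∈ S)

  HasStrongClique : Set
  HasStrongClique = ∃ λ K → IsStrongClique K

  EveryVertexInStrongClique : Set
  EveryVertexInStrongClique = ∀ x → ∃ λ K → x ∈ K × IsStrongClique K

  -- partition of V into strong cliques, given by a labelling of the vertices:
  -- the blocks are the nonempty fibres of the labelling
  PartitionableIntoStrongCliques : Set
  PartitionableIntoStrongCliques =
    Σ (V → ℕ) λ f → ∀ k → (∃ λ v → f v ≡ k) →
      IsStrongClique (λ v → ⌊ f v Data.Nat.≟ k ⌋)

  IsTriangleFree : Set
  IsTriangleFree = ∀ a b c → ¬ (Adj a b × Adj b c × Adj a c)

  IsDiamondFree : Set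
  IsDiamondFree = ∀ a b c d → a ≢ b → a ≢ c → a ≢ d → b ≢ c → b ≢ d → c ≢ d →
    ¬ (Adj a b × Adj a c × Adj a d × Adj b c × Adj b d × ¬ Adj c d)

  IsThreeColorable : Set
  IsThreeColorable = Σ (V → Fin 3) λ col → ∀ u v → Adj u v → col u ≢ col v

degree : {n : ℕ} → Graph (Fin n) → Fin n → ℕ
degree G v = ∣ tabulate (adj G v) ∣

MinDegreeAtLeast : {n : ℕ} → ℕ → Graph (Fin n) → Set
MinDegreeAtLeast d G = ∀ v → d ≤ degree G v

eqF : {m : ℕ} → Fin m → Fin m → Bool
eqF i j = ⌊ i ≟ j ⌋

V' : ℕ → Set
V' n = Fin n × Fin 4

G' : {n : ℕ} → Graph (Fin n) → Graph (V' n)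
adj (G' G) (u , i) (v , j) with eqF u v | eqF i j
... | true  | ij = not ij
... | false | false = false
... | false | true with i
...   | zero  = true
...   | suc _ = adj G u v

C' : {n : ℕ} → VSet (V' n)
C' (_ , zero)  = true
C' (_ , suc _) = false

-- vertices of G'' : V(G') plus a pendant vertex w' for each w = (v , suc i) ∉ C
V'' : ℕ → Set
V'' n = V' n ⊎ (Fin n × Fin 3)

G'' : {n : ℕ} → Graph (Fin n) → Graph (V'' n)
adj (G'' G) (inj₁ a) (inj₁ b) = adj (G' G) a b
adj (G'' G) (inj₁ (u , zero)) (inj₂ _) = false
adj (G'' G) (inj₁ (u , suc i)) (inj₂ (v , j)) = eqF u v ∧ eqF i j
adj (G'' G) (inj₂ _) (inj₁ (v , zero)) = false
adj (G'' G) (inj₂ (u , i)) (inj₁ (v , suc j)) = eqF u v ∧ eqF i j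
adj (G'' G) (inj₂ _) (inj₂ _) = false

C'' : {n : ℕ} → VSet (V'' n)
C'' (inj₁ a) = C' a
C'' (inj₂ _) = false

pendantEdge : {n : ℕ} → Fin n → Fin 3 → VSet (V'' n)
pendantEdge v i (inj₁ (u , zero))  = false
pendantEdge v i (inj₁ (u , suc j)) = eqF u v ∧ eqF j i
pendantEdge v i (inj₂ (u , j))     = eqF u v ∧ eqF j i

-- A proper 3-coloring c of G, read as a choice of layers, gives the maximal stable set
-- {(v , c v)} of G′, which misses C; conversely, a maximal stable set missing C meets every
-- C_v in one of the layers 1-3, which yields a 3-coloring. If G is 3-colorable, no clique K
-- of G′ is strong: K meets these color copies, so it lies inside some C_v or it is an edge of
-- a layer (triangle-freeness leaves no room for a third vertex), and a stable set dominating
-- K, obtained from the degree condition resp. from a permuted coloring, extends to a maximal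
-- stable set missing K. In G″ the pendant edges are always strong, and a strong clique
-- through C restricts to a strong clique of G′, since maximal stable sets of G′ extend to G″
-- by pendant vertices. Diamond-freeness holds because every triangle of G′ lies in one C_v
-- or in C, and pendant vertices have degree 1.

module Submission where

open import Defs
open import Data.Bool using (Bool; true; false; not; _∧_; _∨_)
open import Data.Bool.Properties using (¬-not; not-¬; ⇔→≡) renaming (_≟_ to _≟ᵇ_)
open import Data.Empty using (⊥; ⊥-elim)
open import Data.Fin using (Fin; zero; suc; toℕ; combine)
open import Data.Fin.Properties using (any?; 0≢1+n; toℕ-injective; combine-injectiveˡ; combine-injectiveʳ)
  renaming (_≟_ to _≟ᶠ_; suc-injective to suc-injectiveᶠ)
open import Data.Fin.Subset using (∣_∣)
open import Data.List using (List; []; _∷_; _++_; map; allFin; cartesianProduct)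
open import Data.List.Membership.Propositional using (lose) renaming (_∈_ to _∈ˡ_)
open import Data.List.Membership.Propositional.Properties
  using (∈-allFin; ∈-cartesianProduct⁺; ∈-map⁺; ∈-++⁺ˡ; ∈-++⁺ʳ)
open import Data.List.Relation.Unary.Any using (here; there; satisfied)
import Data.List.Relation.Unary.Any as Any
open import Data.Nat using (ℕ; zero; suc; _≤_; s≤s; s≤s⁻¹)
import Data.Nat as ℕ
open import Data.Nat.Properties using () renaming (suc-injective to suc-injectiveⁿ)
open import Data.Product using (_×_; _,_; Σ; ∃; ∃-syntax; proj₁; proj₂)
open import Data.Product.Properties using () renaming (≡-dec to ×-≡-dec)
open import Data.Sum using (_⊎_; inj₁; inj₂)
open import Data.Sum.Properties using (inj₁-injective) renaming (≡-dec to ⊎-≡-dec)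
open import Data.Vec using (tabulate)
open import Data.Vec.Functional using () renaming (_∷_ to _∷ᶠ_)
open import Function using (_∘_; mk⇔; _⇔_)
open import Function.Definitions using (Injective)
open import Relation.Binary.Definitions using (DecidableEquality)
open import Relation.Binary.PropositionalEquality using (_≡_; _≢_; refl; sym; trans; cong; cong₂; subst)
open import Relation.Nullary using (¬_; Dec; yes; no)
open import Relation.Nullary.Decidable
  using (⌊_⌋; isYes≗does; decidable-stable; dec-true; dec-false; _×-dec_; _⊎-dec_; ¬?)
open import Relation.Unary using (Decidable)

isYes-true : ∀ {P : Set} (p? : Dec P) → P → ⌊ p? ⌋ ≡ true
isYes-true p? p = trans (isYes≗does p?) (dec-true p? p)

isYes⇒ : ∀ {P : Set} (p? : Dec P) → ⌊ p? ⌋ ≡ true → P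
isYes⇒ (yes p) _ = p

module _ {V : Set} (H : Graph V) where

  Dominated : VSet V → V → Set
  Dominated S x = x ∈ S ⊎ ∃[ y ] y ∈ S × Adj H x y

  dominated-mono : ∀ {S T} → S ⊆ T → ∀ {x} → Dominated S x → Dominated T x
  dominated-mono S⊆T (inj₁ x∈S) = inj₁ (S⊆T _ x∈S)
  dominated-mono S⊆T (inj₂ (y , y∈S , x~y)) = inj₂ (y , S⊆T y y∈S , x~y)

  strongClique-resp : ∀ {K L} → K ⊆ L → L ⊆ K → IsStrongClique H K → IsStrongClique H L
  strongClique-resp K⊆L L⊆K (clique , meets) =
    (λ u v u∈L v∈L → clique u v (L⊆K u u∈L) (L⊆K v v∈L)) ,
    λ S maximal → let (v , v∈K , v∈S) = meets S maximal in v , K⊆L v v∈K , v∈S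

module SimpleGraph {V : Set} (H : Graph V) (simple : IsSimple H) where

  adj-sym : ∀ {x y} → Adj H x y → Adj H y x
  adj-sym {x} {y} x~y = trans (proj₁ simple y x) x~y

  adj-irrefl : ∀ {x} → ¬ Adj H x x
  adj-irrefl {x} x~x with () ← trans (sym (proj₂ simple x)) x~x

  adjacent⇒≢ : ∀ {x y} → Adj H x y → x ≢ y
  adjacent⇒≢ x~y refl = adj-irrefl x~y

  stable-nonadjacent : ∀ {S} → IsStable H S → ∀ {x y} → x ∈ S → y ∈ S → ¬ Adj H x y
  stable-nonadjacent stable x∈S y∈S x~y = stable _ _ x∈S y∈S (adjacent⇒≢ x~y) x~y

module FiniteSimpleGraph {V : Set} (H : Graph V) (simple : IsSimple H)
  (_≟_ : DecidableEquality V) (vertices : List V) (complete : ∀ x → x ∈ˡ vertices) where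

  open SimpleGraph H simple public

  ∃? : ∀ {P : V → Set} → Decidable P → Dec (∃ P)
  ∃? P? with Any.any? P? vertices
  ... | yes any = yes (satisfied any)
  ... | no none = no λ (x , px) → none (lose (complete x) px)

  dominated? : ∀ S x → Dec (Dominated H S x)
  dominated? S x = (S x ≟ᵇ true) ⊎-dec ∃? (λ y → (S y ≟ᵇ true) ×-dec (adj H x y ≟ᵇ true))

  insert : V → VSet V → VSet V
  insert x S y = ⌊ y ≟ x ⌋ ∨ S y

  ∈-insert : ∀ x S → x ∈ insert x S
  ∈-insert x S rewrite isYes-true (x ≟ x) refl = refl

  ⊆-insert : ∀ x S → S ⊆ insert x S
  ⊆-insert x S y y∈S with y ≟ x
  ... | yes _ = refl
  ... | no  _ = y∈S

  ∈-insert⁻ : ∀ x S y → y ∈ insert x S → y ≡ x ⊎ y ∈ S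
  ∈-insert⁻ x S y y∈ with y ≟ x
  ... | yes y≡x = inj₁ y≡x
  ... | no  _   = inj₂ y∈

  insert-stable : ∀ {S} x → IsStable H S → (∀ y → y ∈ S → ¬ Adj H x y) →
    IsStable H (insert x S)
  insert-stable {S} x stable x≁S u v u∈ v∈ u≢v u~v
    with ∈-insert⁻ x S u u∈ | ∈-insert⁻ x S v v∈
  ... | inj₁ refl | inj₁ refl = u≢v refl
  ... | inj₁ refl | inj₂ v∈S  = x≁S v v∈S u~v
  ... | inj₂ u∈S  | inj₁ refl = x≁S u u∈S (adj-sym u~v)
  ... | inj₂ u∈S  | inj₂ v∈S  = stable u v u∈S v∈S u≢v u~v

  dominating-stable⇒maximal : ∀ {S} → IsStable H S → (∀ x → Dominated H S x) → IsMaximalStable H S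
  dominating-stable⇒maximal {S} stable dominating = stable , λ T T-stable S⊆T x x∈T →
    case-dominated T-stable S⊆T x∈T (dominating x)
    where
    case-dominated : ∀ {T} → IsStable H T → S ⊆ T → ∀ {x} → x ∈ T → Dominated H S x →
      x ∈ S
    case-dominated _ _ _ (inj₁ x∈S) = x∈S
    case-dominated T-stable S⊆T x∈T (inj₂ (y , y∈S , x~y)) =
      ⊥-elim (stable-nonadjacent T-stable x∈T (S⊆T y y∈S) x~y)

  maximal⇒dominating : ∀ {S} → IsMaximalStable H S → ∀ x → Dominated H S x
  maximal⇒dominating {S} (stable , maximal) x with dominated? S x
  ... | yes dominated = dominated
  ... | no undominated = ⊥-elim (undominated (inj₁ x∈S))
    where
    x∈S : x ∈ S
    x∈S = maximal (insert x S)
      (insert-stable x stable λ y y∈S x~y → undominated (inj₂ (y , y∈S , x~y)))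
      (⊆-insert x S) x (∈-insert x S)

  extend : List V → VSet V → VSet V
  extend [] S = S
  extend (x ∷ xs) S with dominated? S x
  ... | yes _ = extend xs S
  ... | no  _ = extend xs (insert x S)

  ⊆-extend : ∀ xs S → S ⊆ extend xs S
  ⊆-extend [] S = λ _ y∈S → y∈S
  ⊆-extend (x ∷ xs) S with dominated? S x
  ... | yes _ = ⊆-extend xs S
  ... | no  _ = λ y y∈S → ⊆-extend xs (insert x S) y (⊆-insert x S y y∈S)

  extend-stable : ∀ xs {S} → IsStable H S → IsStable H (extend xs S)
  extend-stable [] stable = stable
  extend-stable (x ∷ xs) {S} stable with dominated? S x
  ... | yes _ = extend-stable xs stable
  ... | no undominated = extend-stable xs
        (insert-stable x stable λ y y∈S x~y → undominated (inj₂ (y , y∈S , x~y)))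

  extend-dominates : ∀ xs S {x} → x ∈ˡ xs → Dominated H (extend xs S) x
  extend-dominates (x ∷ xs) S (here refl) with dominated? S x
  ... | yes dominated = dominated-mono H (⊆-extend xs S) dominated
  ... | no  _ = inj₁ (⊆-extend xs (insert x S) x (∈-insert x S))
  extend-dominates (y ∷ xs) S (there x∈xs) with dominated? S y
  ... | yes _ = extend-dominates xs S x∈xs
  ... | no  _ = extend-dominates xs (insert y S) x∈xs

  stable⊆maximal : ∀ {S} → IsStable H S → ∃[ T ] IsMaximalStable H T × S ⊆ T
  stable⊆maximal {S} stable =
    extend vertices S ,
    dominating-stable⇒maximal (extend-stable vertices stable)
      (λ x → extend-dominates vertices S (complete x)) ,
    ⊆-extend vertices S

  -- A stable set dominating K extends to a maximal stable set, which cannot meet K.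
  dominated⇒¬strong : ∀ {S K} → IsStable H S →
    (∀ y → y ∈ K → ∃[ z ] z ∈ S × Adj H y z) → ¬ IsStrongClique H K
  dominated⇒¬strong stable K→S (_ , meets)
    with stable⊆maximal stable
  ... | T , T-maximal , S⊆T with meets T T-maximal
  ... | y , y∈K , y∈T with K→S y y∈K
  ... | z , z∈S , y~z = stable-nonadjacent (proj₁ T-maximal) y∈T (S⊆T z z∈S) y~z

eqF-refl : ∀ {m} (i : Fin m) → eqF i i ≡ true
eqF-refl i = isYes-true (i ≟ᶠ i) refl

eqF⇒≡ : ∀ {m} {i j : Fin m} → eqF i j ≡ true → i ≡ j
eqF⇒≡ {i = i} {j} = isYes⇒ (i ≟ᶠ j)

eqF-false⇒≢ : ∀ {m} {i j : Fin m} → eqF i j ≡ false → i ≢ j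
eqF-false⇒≢ {i = i} e refl with () ← trans (sym e) (eqF-refl i)

eqF-≢ : ∀ {m} {i j : Fin m} → i ≢ j → eqF i j ≡ false
eqF-≢ {i = i} {j} i≢j = trans (isYes≗does (i ≟ᶠ j)) (dec-false (i ≟ᶠ j) i≢j)

eqF-flip : ∀ {m} {i j : Fin m} → eqF i j ≡ true → eqF j i ≡ true
eqF-flip {i = i} e with refl ← eqF⇒≡ e = eqF-refl i

eqF-sym : ∀ {m} (i j : Fin m) → eqF i j ≡ eqF j i
eqF-sym i j = ⇔→≡ (mk⇔ eqF-flip eqF-flip)

eqF-pair⇒≡ : ∀ {m k} {u v : Fin m} {i j : Fin k} → eqF u v ∧ eqF i j ≡ true → (u , i) ≡ (v , j)
eqF-pair⇒≡ {u = u} {v} e with eqF u v in e₁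
... | true = cong₂ _,_ (eqF⇒≡ e₁) (eqF⇒≡ e)

eqF-pair-refl : ∀ {m k} (u : Fin m) (i : Fin k) → eqF u u ∧ eqF i i ≡ true
eqF-pair-refl u i = cong₂ _∧_ (eqF-refl u) (eqF-refl i)

distinctMembers : ∀ {n} k (p : Fin n → Bool) → k ≤ ∣ tabulate p ∣ →
  Σ (Fin k → Fin n) λ w → Injective _≡_ _≡_ w × (∀ i → p (w i) ≡ true)
distinctMembers zero p _ = (λ ()) , (λ { {()} }) , λ ()
distinctMembers {zero} (suc k) p ()
distinctMembers {suc n} (suc k) p k<∣p∣ with p zero in p₀
... | true with distinctMembers k (p ∘ suc) (s≤s⁻¹ k<∣p∣)
...   | w , w-injective , pw = zero ∷ᶠ (suc ∘ w) , injective , λ { zero → p₀ ; (suc i) → pw i }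
  where
  injective : Injective _≡_ _≡_ (zero ∷ᶠ (suc ∘ w))
  injective {zero}  {zero}  _ = refl
  injective {suc i} {suc j} e = cong suc (w-injective (suc-injectiveᶠ e))
distinctMembers {suc n} (suc k) p k<∣p∣ | false with distinctMembers (suc k) (p ∘ suc) k<∣p∣
... | w , w-injective , pw = suc ∘ w , w-injective ∘ suc-injectiveᶠ , pw

rotate : Fin 3 → Fin 3
rotate zero             = suc zero
rotate (suc zero)       = suc (suc zero)
rotate (suc (suc zero)) = zero

rotate³ : ∀ a → rotate (rotate (rotate a)) ≡ a
rotate³ zero             = refl
rotate³ (suc zero)       = refl
rotate³ (suc (suc zero)) = refl

rotate-injective : Injective _≡_ _≡_ rotate
rotate-injective {a} {b} e = trans (sym (rotate³ a)) (trans (cong (rotate ∘ rotate) e) (rotate³ b))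

rotate-≢ : ∀ a → rotate a ≢ a
rotate-≢ zero             ()
rotate-≢ (suc zero)       ()
rotate-≢ (suc (suc zero)) ()

rotate²-≢ : ∀ a → rotate (rotate a) ≢ a
rotate²-≢ zero             ()
rotate²-≢ (suc zero)       ()
rotate²-≢ (suc (suc zero)) ()

recoloring : (a b : Fin 3) → Σ (Fin 3 → Fin 3) λ r → Injective _≡_ _≡_ r × r a ≢ a × r b ≢ a
recoloring a b with rotate b ≟ᶠ a
... | yes refl = rotate ∘ rotate , rotate-injective ∘ rotate-injective ,
                 rotate²-≢ (rotate b) , rotate-≢ (rotate b)
... | no rb≢a  = rotate , rotate-injective , rotate-≢ a , rb≢a

module Construction {n : ℕ} (G : Graph (Fin n)) (simple : IsSimple G) where

  open SimpleGraph G simple using (adj-sym; adj-irrefl; adjacent⇒≢)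

  data Edge′ : V' n → V' n → Set where
    cliqueCᵥ : ∀ {v i j} → i ≢ j → Edge′ (v , i) (v , j)
    cliqueC  : ∀ {u v} → u ≢ v → Edge′ (u , zero) (v , zero)
    layer    : ∀ {u v i} → Adj G u v → Edge′ (u , suc i) (v , suc i)

  edge′-complete : ∀ x y → Adj (G' G) x y → Edge′ x y
  edge′-complete (u , zero) (v , zero) with eqF u v in e
  ... | true  = λ ()
  ... | false = λ _ → cliqueC (eqF-false⇒≢ e)
  edge′-complete (u , zero) (v , suc j) with eqF u v in e
  ... | true  = λ _ → subst (λ w → Edge′ (u , zero) (w , suc j)) (eqF⇒≡ e) (cliqueCᵥ λ ())
  ... | false = λ ()
  edge′-complete (u , suc i) (v , zero) with eqF u v in e
  ... | true  = λ _ → subst (λ w → Edge′ (u , suc i) (w , zero)) (eqF⇒≡ e) (cliqueCᵥ λ ())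
  ... | false = λ ()
  edge′-complete (u , suc i) (v , suc j) with eqF u v in e | eqF {4} (suc i) (suc j) in f
  ... | true  | true  = λ ()
  ... | true  | false = λ _ →
    subst (λ w → Edge′ (u , suc i) (w , suc j)) (eqF⇒≡ e) (cliqueCᵥ (eqF-false⇒≢ f))
  ... | false | true with refl ← eqF⇒≡ f = layer
  ... | false | false = λ ()

  edge′-sound : ∀ {x y} → Edge′ x y → Adj (G' G) x y
  edge′-sound (cliqueCᵥ {v} i≢j) rewrite eqF-refl v | eqF-≢ i≢j = refl
  edge′-sound (cliqueC u≢v) rewrite eqF-≢ u≢v = refl
  edge′-sound (layer {i = i} u~v) rewrite eqF-≢ (adjacent⇒≢ u~v) | eqF-refl {4} (suc i) = u~v

  edge′-sym : ∀ {x y} → Edge′ x y → Edge′ y x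
  edge′-sym (cliqueCᵥ i≢j) = cliqueCᵥ (i≢j ∘ sym)
  edge′-sym (cliqueC u≢v)  = cliqueC (u≢v ∘ sym)
  edge′-sym (layer u~v)    = layer (adj-sym u~v)

  edge′-irrefl : ∀ {x} → ¬ Edge′ x x
  edge′-irrefl (cliqueCᵥ i≢i) = i≢i refl
  edge′-irrefl (cliqueC u≢u)  = u≢u refl
  edge′-irrefl (layer u~u)    = adj-irrefl u~u

  G′-simple : IsSimple (G' G)
  G′-simple =
    (λ x y → ⇔→≡ (mk⇔ (edge′-sound ∘ edge′-sym ∘ edge′-complete x y)
                      (edge′-sound ∘ edge′-sym ∘ edge′-complete y x))) ,
    (λ x → ¬-not (edge′-irrefl ∘ edge′-complete x x))

  anchor : Fin n × Fin 3 → V' n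
  anchor (v , i) = (v , suc i)

  pendant-neighbor : ∀ p y → Adj (G'' G) (inj₂ p) y → y ≡ inj₁ (anchor p)
  pendant-neighbor (u , i) (inj₁ (v , suc j)) a with refl ← eqF-pair⇒≡ {u = u} {v} {i} {j} a = refl

  pendant-adjacent : ∀ p → Adj (G'' G) (inj₂ p) (inj₁ (anchor p))
  pendant-adjacent (v , i) = eqF-pair-refl v i

  G″-sym : ∀ x y → adj (G'' G) x y ≡ adj (G'' G) y x
  G″-sym (inj₁ a) (inj₁ b) = proj₁ G′-simple a b
  G″-sym (inj₁ (u , zero)) (inj₂ _) = refl
  G″-sym (inj₁ (u , suc i)) (inj₂ (v , j)) = cong₂ _∧_ (eqF-sym u v) (eqF-sym i j)
  G″-sym (inj₂ _) (inj₁ (v , zero)) = refl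
  G″-sym (inj₂ (u , i)) (inj₁ (v , suc j)) = cong₂ _∧_ (eqF-sym u v) (eqF-sym i j)
  G″-sym (inj₂ _) (inj₂ _) = refl

  G″-simple : IsSimple (G'' G)
  G″-simple = G″-sym , λ { (inj₁ a) → proj₂ G′-simple a ; (inj₂ _) → refl }

  pendant-neighborˡ : ∀ p y → Adj (G'' G) y (inj₂ p) → y ≡ inj₁ (anchor p)
  pendant-neighborˡ p y a = pendant-neighbor p y (trans (G″-sym (inj₂ p) y) a)

  V′-vertices : List (V' n)
  V′-vertices = cartesianProduct (allFin n) (allFin 4)

  V′-complete : ∀ x → x ∈ˡ V′-vertices
  V′-complete (v , i) = ∈-cartesianProduct⁺ (∈-allFin v) (∈-allFin i)

  V″-vertices : List (V'' n)
  V″-vertices = map inj₁ V′-vertices ++ map inj₂ (cartesianProduct (allFin n) (allFin 3))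

  V″-complete : ∀ x → x ∈ˡ V″-vertices
  V″-complete (inj₁ a) = ∈-++⁺ˡ (∈-map⁺ inj₁ (V′-complete a))
  V″-complete (inj₂ (v , i)) =
    ∈-++⁺ʳ (map inj₁ V′-vertices)
      (∈-map⁺ inj₂ (∈-cartesianProduct⁺ (∈-allFin v) (∈-allFin i)))

  _≟′_ : DecidableEquality (V' n)
  _≟′_ = ×-≡-dec _≟ᶠ_ _≟ᶠ_

  module G′ = FiniteSimpleGraph (G' G) G′-simple _≟′_ V′-vertices V′-complete
  module G″ = FiniteSimpleGraph (G'' G) G″-simple (⊎-≡-dec _≟′_ (×-≡-dec _≟ᶠ_ _≟ᶠ_))
    V″-vertices V″-complete

  IsProperColoring : (Fin n → Fin 3) → Set
  IsProperColoring c = ∀ u v → Adj G u v → c u ≢ c v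

  proper-∘ : ∀ {c} {r : Fin 3 → Fin 3} → Injective _≡_ _≡_ r →
    IsProperColoring c → IsProperColoring (r ∘ c)
  proper-∘ r-injective proper u v u~v = proper u v u~v ∘ r-injective

  colorCopies : (Fin n → Fin 3) → VSet (V' n)
  colorCopies c (v , zero)  = false
  colorCopies c (v , suc i) = eqF i (c v)

  colorCopies-stable : ∀ {c} → IsProperColoring c → IsStable (G' G) (colorCopies c)
  colorCopies-stable proper (u , suc i) (v , suc j) x∈ y∈ _ x~y
    with edge′-complete (u , suc i) (v , suc j) x~y
  ... | cliqueCᵥ i≢j = i≢j (cong suc (trans (eqF⇒≡ x∈) (sym (eqF⇒≡ y∈))))
  ... | layer u~v    = proper u v u~v (trans (sym (eqF⇒≡ x∈)) (eqF⇒≡ y∈))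

  colorCopies-maximal : ∀ {c} → IsProperColoring c → IsMaximalStable (G' G) (colorCopies c)
  colorCopies-maximal {c} proper = G′.dominating-stable⇒maximal (colorCopies-stable proper) dominating
    where
    dominating : ∀ x → Dominated (G' G) (colorCopies c) x
    dominating (v , i) with i ≟ᶠ suc (c v)
    ... | yes refl = inj₁ (eqF-refl (c v))
    ... | no i≢cv  = inj₂ ((v , suc (c v)) , eqF-refl (c v) , edge′-sound (cliqueCᵥ {v = v} i≢cv))

  transversal : (Fin 4 → Fin n) → VSet (V' n)
  transversal f (x , l) = eqF x (f l)

  transversal-stable : ∀ {f} → Injective _≡_ _≡_ f → IsStable (G' G) (transversal f)
  transversal-stable f-injective (x , k) (y , l) x∈ y∈ _ x~y
    with edge′-complete (x , k) (y , l) x~y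
  ... | cliqueCᵥ k≢l = k≢l (f-injective (trans (sym (eqF⇒≡ x∈)) (eqF⇒≡ y∈)))
  ... | cliqueC x≢y  = x≢y (trans (eqF⇒≡ x∈) (sym (eqF⇒≡ y∈)))
  ... | layer x~y    = adjacent⇒≢ x~y (trans (eqF⇒≡ x∈) (sym (eqF⇒≡ y∈)))

  C′-clique : IsClique (G' G) C'
  C′-clique (u , zero) (v , zero) _ _ x≢y = edge′-sound (cliqueC {u} {v} λ { refl → x≢y refl })

  -- If S misses C, every (v , 0) is dominated by some (v , suc i) ∈ S, and i is a proper color of v.
  dominatesC⇒meetsC : ¬ IsThreeColorable G → ∀ {S} → IsStable (G' G) S →
    (∀ v → Dominated (G' G) S (v , zero)) → ∃[ x ] x ∈ C' × x ∈ S
  dominatesC⇒meetsC ¬3col {S} stable dominated with any? (λ v → S (v , zero) ≟ᵇ true)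
  ... | yes (v , v₀∈S) = (v , zero) , refl , v₀∈S
  ... | no none = ⊥-elim (¬3col (color , proper))
    where
    copy : ∀ v → ∃[ i ] (v , suc i) ∈ S
    copy v with dominated v
    ... | inj₁ v₀∈S = ⊥-elim (none (v , v₀∈S))
    ... | inj₂ (y , y∈S , v₀~y) with edge′-complete (v , zero) y v₀~y
    ...   | cliqueCᵥ {j = zero} 0≢0 = ⊥-elim (0≢0 refl)
    ...   | cliqueCᵥ {j = suc i} _ = i , y∈S
    ...   | cliqueC _ = ⊥-elim (none (_ , y∈S))

    color : Fin n → Fin 3
    color v = proj₁ (copy v)

    proper : IsProperColoring color
    proper u v u~v same = G′.stable-nonadjacent stable
      (subst (λ k → (u , suc k) ∈ S) same (proj₂ (copy u))) (proj₂ (copy v))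
      (edge′-sound (layer u~v))

  C′-strong : ¬ IsThreeColorable G → IsStrongClique (G' G) C'
  C′-strong ¬3col = C′-clique , λ S maximal →
    dominatesC⇒meetsC ¬3col (proj₁ maximal) (λ v → G′.maximal⇒dominating maximal (v , zero))

  restrict : VSet (V'' n) → VSet (V' n)
  restrict S a = S (inj₁ a)

  restrict-stable : ∀ {S} → IsStable (G'' G) S → IsStable (G' G) (restrict S)
  restrict-stable stable a b a∈ b∈ a≢b =
    stable (inj₁ a) (inj₁ b) a∈ b∈ (a≢b ∘ inj₁-injective)

  restrict-dominatedC : ∀ {S v} → Dominated (G'' G) S (inj₁ (v , zero)) →
    Dominated (G' G) (restrict S) (v , zero)
  restrict-dominatedC (inj₁ v₀∈S) = inj₁ v₀∈S
  restrict-dominatedC (inj₂ (inj₁ b , b∈S , v₀~b)) = inj₂ (b , b∈S , v₀~b)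

  C″-clique : IsClique (G'' G) C''
  C″-clique (inj₁ a) (inj₁ b) a∈ b∈ a≢b = C′-clique a b a∈ b∈ (a≢b ∘ cong inj₁)

  C″-strong : ¬ IsThreeColorable G → IsStrongClique (G'' G) C''
  C″-strong ¬3col = C″-clique , λ S maximal →
    let (x , x∈C , x∈S) = dominatesC⇒meetsC ¬3col (restrict-stable (proj₁ maximal))
          (λ v → restrict-dominatedC (G″.maximal⇒dominating maximal (inj₁ (v , zero))))
    in inj₁ x , x∈C , x∈S

  pendantEdge-members : ∀ (v : Fin n) i x → x ∈ pendantEdge v i →
    x ≡ inj₁ (v , suc i) ⊎ x ≡ inj₂ (v , i)
  pendantEdge-members v i (inj₁ (u , suc j)) x∈
    with refl ← eqF-pair⇒≡ {u = u} {v} {j} {i} x∈ = inj₁ refl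
  pendantEdge-members v i (inj₂ (u , j)) x∈
    with refl ← eqF-pair⇒≡ {u = u} {v} {j} {i} x∈ = inj₂ refl

  pendantEdge-clique : ∀ (v : Fin n) i → IsClique (G'' G) (pendantEdge v i)
  pendantEdge-clique v i x y x∈ y∈ x≢y
    with pendantEdge-members v i x x∈ | pendantEdge-members v i y y∈
  ... | inj₁ refl | inj₁ refl = ⊥-elim (x≢y refl)
  ... | inj₁ refl | inj₂ refl =
    trans (G″-sym (inj₁ (v , suc i)) (inj₂ (v , i))) (pendant-adjacent (v , i))
  ... | inj₂ refl | inj₁ refl = pendant-adjacent (v , i)
  ... | inj₂ refl | inj₂ refl = ⊥-elim (x≢y refl)

  -- A maximal stable set avoiding w contains the pendant vertex w′, whose only neighbor is w.
  pendantEdge-strong : ∀ (v : Fin n) i → IsStrongClique (G'' G) (pendantEdge v i)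
  pendantEdge-strong v i = pendantEdge-clique v i , meets
    where
    meets : ∀ S → IsMaximalStable (G'' G) S → ∃[ x ] x ∈ pendantEdge v i × x ∈ S
    meets S maximal with G″.maximal⇒dominating maximal (inj₂ (v , i))
    ... | inj₁ w′∈S = inj₂ (v , i) , eqF-pair-refl v i , w′∈S
    ... | inj₂ (y , y∈S , w′~y) with refl ← pendant-neighbor (v , i) y w′~y =
      inj₁ (v , suc i) , eqF-pair-refl v i , y∈S

  pendantExtension : VSet (V' n) → VSet (V'' n)
  pendantExtension S (inj₁ a) = S a
  pendantExtension S (inj₂ p) = not (S (anchor p))

  pendantExtension-maximal : ∀ {S} → IsMaximalStable (G' G) S →
    IsMaximalStable (G'' G) (pendantExtension S)
  pendantExtension-maximal {S} maximal = G″.dominating-stable⇒maximal stable dominating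
    where
    stable : IsStable (G'' G) (pendantExtension S)
    stable (inj₁ a) (inj₁ b) a∈ b∈ a≢b = proj₁ maximal a b a∈ b∈ (a≢b ∘ cong inj₁)
    stable (inj₁ a) (inj₂ p) a∈ p∈ _ a~p with refl ← pendant-neighborˡ p (inj₁ a) a~p =
      not-¬ (sym a∈) (sym p∈)
    stable (inj₂ p) y p∈ y∈ _ p~y with refl ← pendant-neighbor p y p~y = not-¬ (sym y∈) (sym p∈)

    dominating : ∀ x → Dominated (G'' G) (pendantExtension S) x
    dominating (inj₁ a) with G′.maximal⇒dominating maximal a
    ... | inj₁ a∈S = inj₁ a∈S
    ... | inj₂ (b , b∈S , a~b) = inj₂ (inj₁ b , b∈S , a~b)
    dominating (inj₂ p) with S (anchor p) in anchor∈S
    ... | true  = inj₂ (inj₁ (anchor p) , anchor∈S , pendant-adjacent p)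
    ... | false = inj₁ refl

  restrict-strong : ∀ {K} → IsStrongClique (G'' G) K → (∀ p → ¬ inj₂ p ∈ K) →
    IsStrongClique (G' G) (restrict K)
  restrict-strong {K} (clique , meets) no-pendant =
    (λ a b a∈ b∈ a≢b → clique (inj₁ a) (inj₁ b) a∈ b∈ (a≢b ∘ inj₁-injective)) , meets′
    where
    meets′ : ∀ S → IsMaximalStable (G' G) S → ∃[ a ] a ∈ restrict K × a ∈ S
    meets′ S maximal with meets (pendantExtension S) (pendantExtension-maximal maximal)
    ... | inj₁ a , a∈K , a∈S = a , a∈K , a∈S
    ... | inj₂ p , p∈K , _   = ⊥-elim (no-pendant p p∈K)

  strongThroughC⇒hasStrongClique′ : ∀ {K v} → IsStrongClique (G'' G) K → inj₁ (v , zero) ∈ K →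
    HasStrongClique (G' G)
  strongThroughC⇒hasStrongClique′ {K} {v} strong v₀∈K = restrict K , restrict-strong strong no-pendant
    where
    no-pendant : ∀ p → ¬ inj₂ p ∈ K
    no-pendant p p∈K with () ← proj₁ strong (inj₁ (v , zero)) (inj₂ p) v₀∈K p∈K (λ ())

  pendantCode : Fin n → Fin 3 → ℕ
  pendantCode v i = suc (toℕ (combine v i))

  pendantCode-injective : ∀ {u j v i} → pendantCode u j ≡ pendantCode v i → (u , j) ≡ (v , i)
  pendantCode-injective {u} {j} {v} {i} e =
    cong₂ _,_ (combine-injectiveˡ u j v i same) (combine-injectiveʳ u j v i same)
    where same = toℕ-injective (suc-injectiveⁿ e)

  blockOf : V'' n → ℕ
  blockOf (inj₁ (v , zero))  = 0
  blockOf (inj₁ (v , suc i)) = pendantCode v i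
  blockOf (inj₂ (v , i))     = pendantCode v i

  block : ℕ → VSet (V'' n)
  block k x = ⌊ blockOf x ℕ.≟ k ⌋

  C″⊆block₀ : C'' ⊆ block 0
  C″⊆block₀ (inj₁ (v , zero)) _ = refl

  block₀⊆C″ : block 0 ⊆ C''
  block₀⊆C″ (inj₁ (v , zero)) _ = refl

  pendantEdge⊆block : ∀ (v : Fin n) i → pendantEdge v i ⊆ block (pendantCode v i)
  pendantEdge⊆block v i x x∈ with pendantEdge-members v i x x∈
  ... | inj₁ refl = isYes-true (pendantCode v i ℕ.≟ pendantCode v i) refl
  ... | inj₂ refl = isYes-true (pendantCode v i ℕ.≟ pendantCode v i) refl

  block⊆pendantEdge : ∀ (v : Fin n) i → block (pendantCode v i) ⊆ pendantEdge v i
  block⊆pendantEdge v i (inj₁ (u , suc j)) x∈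
    with refl ← pendantCode-injective (isYes⇒ (pendantCode u j ℕ.≟ pendantCode v i) x∈) =
    eqF-pair-refl u j
  block⊆pendantEdge v i (inj₂ (u , j)) x∈
    with refl ← pendantCode-injective (isYes⇒ (pendantCode u j ℕ.≟ pendantCode v i) x∈) =
    eqF-pair-refl u j

  pendantBlock-strong : ∀ (v : Fin n) i → IsStrongClique (G'' G) (block (pendantCode v i))
  pendantBlock-strong v i =
    strongClique-resp (G'' G) (pendantEdge⊆block v i) (block⊆pendantEdge v i) (pendantEdge-strong v i)

  partition : ¬ IsThreeColorable G → PartitionableIntoStrongCliques (G'' G)
  partition ¬3col = blockOf , λ where
    _ (inj₁ (v , zero) , refl) →
      strongClique-resp (G'' G) C″⊆block₀ block₀⊆C″ (C″-strong ¬3col)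
    _ (inj₁ (v , suc i) , refl) → pendantBlock-strong v i
    _ (inj₂ (v , i) , refl) → pendantBlock-strong v i

  everyVertexInStrongClique : ¬ IsThreeColorable G → EveryVertexInStrongClique (G'' G)
  everyVertexInStrongClique ¬3col (inj₁ (v , zero))  = C'' , refl , C″-strong ¬3col
  everyVertexInStrongClique ¬3col (inj₁ (v , suc i)) =
    pendantEdge v i , eqF-pair-refl v i , pendantEdge-strong v i
  everyVertexInStrongClique ¬3col (inj₂ (v , i)) =
    pendantEdge v i , eqF-pair-refl v i , pendantEdge-strong v i

  data InOneClique : V' n → V' n → V' n → Set where
    inCᵥ : ∀ {v i j k} → InOneClique (v , i) (v , j) (v , k)
    inC  : ∀ {u v w} → InOneClique (u , zero) (v , zero) (w , zero)

  inOneClique-adjacent : ∀ {a b c d} → a ≢ b → c ≢ d →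
    InOneClique a b c → InOneClique a b d → Edge′ c d
  inOneClique-adjacent _ c≢d inCᵥ inCᵥ = cliqueCᵥ λ { refl → c≢d refl }
  inOneClique-adjacent _ c≢d inC  inC  = cliqueC λ { refl → c≢d refl }
  inOneClique-adjacent a≢b _ inCᵥ inC  = ⊥-elim (a≢b refl)
  inOneClique-adjacent a≢b _ inC  inCᵥ = ⊥-elim (a≢b refl)

  module _ (triangleFree : IsTriangleFree G) where

    no-common-neighbor : ∀ {v w i y} → Adj G v w →
      Edge′ (v , suc i) y → Edge′ (w , suc i) y → ⊥
    no-common-neighbor v~w (cliqueCᵥ _)   (cliqueCᵥ _)   = adj-irrefl v~w
    no-common-neighbor v~w (cliqueCᵥ i≢i) (layer _)      = i≢i refl
    no-common-neighbor v~w (layer _)      (cliqueCᵥ i≢i) = i≢i refl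
    no-common-neighbor v~w (layer v~t)    (layer w~t)    = triangleFree _ _ _ (v~w , w~t , v~t)

    triangle⇒inOneClique : ∀ {x y z} → Edge′ x y → Edge′ y z → Edge′ x z → InOneClique x y z
    triangle⇒inOneClique (cliqueCᵥ _) (cliqueCᵥ _) _ = inCᵥ
    triangle⇒inOneClique (cliqueCᵥ _) (cliqueC v≢v) (cliqueCᵥ _) = ⊥-elim (v≢v refl)
    triangle⇒inOneClique (cliqueCᵥ _) (cliqueC _) (cliqueC _) = inC
    triangle⇒inOneClique (cliqueCᵥ _) (layer v~v) (cliqueCᵥ _) = ⊥-elim (adj-irrefl v~v)
    triangle⇒inOneClique (cliqueCᵥ i≢i) (layer _) (layer _) = ⊥-elim (i≢i refl)
    triangle⇒inOneClique (cliqueC _) (cliqueCᵥ _) (cliqueC _) = inC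
    triangle⇒inOneClique (cliqueC u≢u) (cliqueCᵥ _) (cliqueCᵥ _) = ⊥-elim (u≢u refl)
    triangle⇒inOneClique (cliqueC _) (cliqueC _) _ = inC
    triangle⇒inOneClique (layer u~v) y~z x~z = ⊥-elim (no-common-neighbor u~v x~z y~z)

    G′-diamondFree : IsDiamondFree (G' G)
    G′-diamondFree a b c d a≢b _ _ _ _ c≢d (a~b , a~c , a~d , b~c , b~d , c≁d) =
      c≁d (edge′-sound (inOneClique-adjacent a≢b c≢d (triangle c a~c b~c) (triangle d a~d b~d)))
      where
      triangle : ∀ z → Adj (G' G) a z → Adj (G' G) b z → InOneClique a b z
      triangle z a~z b~z = triangle⇒inOneClique
        (edge′-complete a b a~b) (edge′-complete b z b~z) (edge′-complete a z a~z)

    -- Each vertex of a diamond has two distinct neighbors in it, a pendant vertex only one.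
    G″-diamondFree : IsDiamondFree (G'' G)
    G″-diamondFree (inj₂ p) b c _ _ _ _ b≢c _ _ (a~b , a~c , _) =
      b≢c (trans (pendant-neighbor p b a~b) (sym (pendant-neighbor p c a~c)))
    G″-diamondFree (inj₁ a) (inj₂ p) c _ _ a≢c _ _ _ _ (a~b , _ , _ , b~c , _) =
      a≢c (trans (pendant-neighborˡ p (inj₁ a) a~b) (sym (pendant-neighbor p c b~c)))
    G″-diamondFree (inj₁ a) (inj₁ b) (inj₂ p) _ a≢b _ _ _ _ _ (_ , a~c , _ , b~c , _) =
      a≢b (trans (pendant-neighborˡ p (inj₁ a) a~c) (sym (pendant-neighborˡ p (inj₁ b) b~c)))
    G″-diamondFree (inj₁ a) (inj₁ b) (inj₁ c) (inj₂ p) a≢b _ _ _ _ _ (_ , _ , a~d , _ , b~d , _) =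
      a≢b (trans (pendant-neighborˡ p (inj₁ a) a~d) (sym (pendant-neighborˡ p (inj₁ b) b~d)))
    G″-diamondFree (inj₁ a) (inj₁ b) (inj₁ c) (inj₁ d) a≢b a≢c a≢d b≢c b≢d c≢d =
      G′-diamondFree a b c d (a≢b ∘ cong inj₁) (a≢c ∘ cong inj₁) (a≢d ∘ cong inj₁)
        (b≢c ∘ cong inj₁) (b≢d ∘ cong inj₁) (c≢d ∘ cong inj₁)

    -- After permuting the colors so that neither v nor w keeps the color c v, the color
    -- copies dominate both ends of the layer edge.
    layerEdge⇒¬strong : ∀ {K c v w} → IsProperColoring c → Adj G v w → IsClique (G' G) K →
      (v , suc (c v)) ∈ K → (w , suc (c v)) ∈ K → ¬ IsStrongClique (G' G) K
    layerEdge⇒¬strong {K} {c} {v} {w} proper v~w clique x∈K z∈K with recoloring (c v) (c w)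
    ... | r , r-injective , rcv≢cv , rcw≢cv =
      G′.dominated⇒¬strong (colorCopies-stable (proper-∘ r-injective proper)) dominated
      where
      dominated : ∀ y → y ∈ K → ∃[ z ] z ∈ colorCopies (r ∘ c) × Adj (G' G) y z
      dominated y y∈K with y ≟′ (v , suc (c v)) | y ≟′ (w , suc (c v))
      ... | yes refl | _ =
        (v , suc (r (c v))) , eqF-refl _ ,
        edge′-sound (cliqueCᵥ {v = v} (rcv≢cv ∘ sym ∘ suc-injectiveᶠ))
      ... | no _ | yes refl =
        (w , suc (r (c w))) , eqF-refl _ ,
        edge′-sound (cliqueCᵥ {v = w} (rcw≢cv ∘ sym ∘ suc-injectiveᶠ))
      ... | no y≢x | no y≢z = ⊥-elim (no-common-neighbor v~w
        (edge′-complete (v , suc (c v)) y (clique _ _ x∈K y∈K (y≢x ∘ sym)))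
        (edge′-complete (w , suc (c v)) y (clique _ _ z∈K y∈K (y≢z ∘ sym))))

    module _ (minDegree : MinDegreeAtLeast 3 G) where

      neighborOtherThan : ∀ w v → ∃[ u ] Adj G w u × u ≢ v
      neighborOtherThan w v with distinctMembers 3 (adj G w) (minDegree w)
      ... | t , t-injective , w~t with t zero ≟ᶠ v
      ... | no t₀≢v = t zero , w~t zero , t₀≢v
      ... | yes t₀≡v = t (suc zero) , w~t (suc zero) , λ t₁≡v →
        0≢1+n (t-injective (trans t₀≡v (sym t₁≡v)))

      -- For neighbors w₀, w₁, w₂ of v and a neighbor u ≠ v of w₀, the set
      -- {(u , 0), (w₀ , 1), (w₁ , 2), (w₂ , 3)} is stable, as triangle-freeness makes
      -- u, w₀, w₁, w₂ distinct, and it dominates C_v.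
      insideCᵥ⇒¬strong : ∀ {K} v → (∀ y → y ∈ K → proj₁ y ≡ v) →
        ¬ IsStrongClique (G' G) K
      insideCᵥ⇒¬strong {K} v K⊆Cᵥ with distinctMembers 3 (adj G v) (minDegree v)
      ... | w , w-injective , v~w with neighborOtherThan (w zero) v
      ... | u , w₀~u , u≢v = G′.dominated⇒¬strong (transversal-stable f-injective) dominated
        where
        u≢w : ∀ l → u ≢ w l
        u≢w zero    refl = adj-irrefl w₀~u
        u≢w (suc l) refl = triangleFree v (w zero) (w (suc l)) (v~w zero , w₀~u , v~w (suc l))

        f : Fin 4 → Fin n
        f = u ∷ᶠ w

        f-injective : Injective _≡_ _≡_ f
        f-injective {zero}  {zero}  _ = refl
        f-injective {zero}  {suc l} e = ⊥-elim (u≢w l e)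
        f-injective {suc k} {zero}  e = ⊥-elim (u≢w k (sym e))
        f-injective {suc k} {suc l} e = cong suc (w-injective e)

        dominated : ∀ y → y ∈ K → ∃[ z ] z ∈ transversal f × Adj (G' G) y z
        dominated y y∈K with K⊆Cᵥ y y∈K
        dominated (_ , zero)  _ | refl = (u , zero) , eqF-refl u , edge′-sound (cliqueC (u≢v ∘ sym))
        dominated (_ , suc i) _ | refl = (w i , suc i) , eqF-refl (w i) , edge′-sound (layer (v~w i))

      strongClique⇒¬3colorable : HasStrongClique (G' G) → ¬ IsThreeColorable G
      strongClique⇒¬3colorable (K , strong@(clique , meets)) (c , proper)
        with meets (colorCopies c) (colorCopies-maximal proper)
      ... | (v , suc i) , x∈K , x∈S with refl ← eqF⇒≡ x∈S
          with G′.∃? (λ y → (K y ≟ᵇ true) ×-dec ¬? (proj₁ y ≟ᶠ v))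
      ... | no none = insideCᵥ⇒¬strong v
            (λ y y∈K → decidable-stable (proj₁ y ≟ᶠ v) (λ y≢v → none (y , y∈K , y≢v))) strong
      ... | yes ((w , l) , y∈K , w≢v)
          with edge′-complete (v , suc (c v)) (w , l) (clique _ _ x∈K y∈K λ { refl → w≢v refl })
      ...   | cliqueCᵥ _ = w≢v refl
      ...   | layer v~w = layerEdge⇒¬strong proper v~w clique x∈K y∈K strong

proposition3 : (n : ℕ) → (G : Graph (Fin n)) → IsSimple G → 5 ≤ n →
    IsTriangleFree G → MinDegreeAtLeast 3 G →
    IsDiamondFree (G' G) × IsDiamondFree (G'' G) ×
    ((¬ IsThreeColorable G) ⇔ IsStrongClique (G' G) C') ×
    ((¬ IsThreeColorable G) ⇔ HasStrongClique (G' G)) ×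
    ((¬ IsThreeColorable G) ⇔ IsStrongClique (G'' G) C'') ×
    ((¬ IsThreeColorable G) ⇔ EveryVertexInStrongClique (G'' G)) ×
    ((¬ IsThreeColorable G) ⇔
      (IsStrongClique (G'' G) C'' × (∀ v i → IsStrongClique (G'' G) (pendantEdge v i)))) ×
    ((¬ IsThreeColorable G) ⇔ PartitionableIntoStrongCliques (G'' G))
proposition3 (suc m) G simple (s≤s _) triangleFree minDegree =
  G′-diamondFree triangleFree ,
  G″-diamondFree triangleFree ,
  mk⇔ C′-strong (λ strong → ¬3colorable′ (C' , strong)) ,
  mk⇔ (λ ¬3col → C' , C′-strong ¬3col) ¬3colorable′ ,
  mk⇔ C″-strong (λ strong → ¬3colorable″ strong refl) ,
  mk⇔ everyVertexInStrongClique
    (λ every → let (_ , x₀∈K , strong) = every x₀ in ¬3colorable″ strong x₀∈K) ,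
  mk⇔ (λ ¬3col → C″-strong ¬3col , pendantEdge-strong) (λ (strong , _) → ¬3colorable″ strong refl) ,
  mk⇔ partition
    (λ (f , blocks) → ¬3colorable″ (blocks (f x₀) (x₀ , refl)) (isYes-true (f x₀ ℕ.≟ f x₀) refl))
  where
  open Construction G simple

  x₀ : V'' (suc m)
  x₀ = inj₁ (zero , zero)

  ¬3colorable′ : HasStrongClique (G' G) → ¬ IsThreeColorable G
  ¬3colorable′ = strongClique⇒¬3colorable triangleFree minDegree

  ¬3colorable″ : ∀ {K} → IsStrongClique (G'' G) K → x₀ ∈ K → ¬ IsThreeColorable G
  ¬3colorable″ strong x₀∈K = ¬3colorable′ (strongThroughC⇒hasStrongClique′ strong x₀∈K)
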